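{- Let $w$ be a word of length $n\ge 1$ over an alphabet $\Sigma$. Then $$SP_4(w)\le\begin{cases}\dfrac{n^2-2n}{4}, & n \text{ even},\\[2mm] \left(\dfrac{n-1}{2}\right)^2, & n\text{ odd}.\end{cases}$$
   Context: A scattered subword of $w$ is a (not necessarily contiguous) subsequence of $w$. A palindrome is a word equal to its reversal. For $t\ge 1$, $SP_t(w)$ is the number of distinct palindromes of length $t$ that are scattered subwords of $w$. -}

module Defs where

open import Data.Nat using (ℕ; _≟_)
open import Data.List using (List; []; _∷_; map; _++_; filter; length; reverse; deduplicate)
open import Data.List.Properties using (≡-dec)
open import Data.Product using (_×_)
open import Relation.Binary.PropositionalEquality using (_≡_)
open import Relation.Binary.Definitions using (DecidableEquality)
open import Relation.Nullary.Decidable using (_×-dec_)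

scatteredSubwords : {Σ : Set} → List Σ → List (List Σ)
scatteredSubwords [] = [] ∷ []
scatteredSubwords (x ∷ xs) = map (x ∷_) s ++ s
  where s = scatteredSubwords xs

IsPalindrome : {Σ : Set} → List Σ → Set
IsPalindrome p = reverse p ≡ p

SP : {Σ : Set} → DecidableEquality Σ → ℕ → List Σ → ℕ
SP _≟Σ_ t w =
  length (deduplicate (≡-dec _≟Σ_)
    (filter (λ p → (length p ≟ t) ×-dec ≡-dec _≟Σ_ (reverse p) p)
      (scatteredSubwords w)))

{-# OPTIONS --safe #-}
-- A palindrome of length 4 has the form a c c a. Prepending a letter x to w can only add the
-- palindromes x c c x in which c c is a scattered subword of w, i.e. c occurs at least twice in w;
-- there are at most ⌊|w|/2⌋ such letters c. Hence SP₄(w) ≤ Σ_{i<n} ⌊i/2⌋, and this sum is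
-- (n² − 2n)/4 for even n and ((n − 1)/2)² for odd n.
module Submission where

open import Defs
open import Data.Nat using (ℕ; zero; suc; _+_; _*_; _∸_; _/_; _%_; _^_; ⌊_/2⌋; _≤_; _≤?_; z≤n; s≤s)
  renaming (_≟_ to _≟ℕ_)
open import Data.Nat.Properties
open import Data.Nat.DivMod using (m≡m%n+[m/n]*n; m*n/n≡m)
open import Data.Nat.Solver using (module +-*-Solver)
open +-*-Solver using (solve; _:+_; _:*_; _:=_; con)
open import Data.List using (List; []; _∷_; length; map; _++_; filter; reverse; deduplicate)
open import Data.List.Properties using (≡-dec; filter-accept; filter-reject; filter-some; length-++; length-map)
open import Data.List.Membership.Propositional using (_∈_)
open import Data.List.Membership.Propositional.Properties
  using (∈-++⁺ˡ; ∈-++⁺ʳ; ∈-++⁻; ∈-map⁺; ∈-map⁻; ∈-filter⁺; ∈-filter⁻; ∈-deduplicate⁺; ∈-deduplicate⁻)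
open import Data.List.Relation.Unary.Any using (here)
open import Data.List.Relation.Unary.All as All using (All; []; _∷_)
open import Data.List.Relation.Unary.AllPairs using ([]; _∷_)
open import Data.List.Relation.Unary.Unique.Propositional using (Unique)
import Data.List.Relation.Unary.Unique.DecPropositional.Properties as UniqueDec
open import Data.List.Relation.Binary.Sublist.Propositional using (_⊆_; []; _∷_; _∷ʳ_; lookup)
open import Data.List.Relation.Binary.Sublist.Propositional.Properties using (filter⁺; length-mono-≤)
open import Data.Product using (_×_; _,_; proj₁; proj₂; ∃₂)
open import Data.Sum using (inj₁; inj₂)
open import Function using (_∘_)
open import Level using (Level)
open import Relation.Nullary using (yes; no; ¬_)
open import Relation.Nullary.Decidable using (_×-dec_)
open import Relation.Unary using (Pred) renaming (Decidable to Decidable₁)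
open import Relation.Unary.Properties using (∁?)
open import Relation.Binary.Definitions using (DecidableEquality)
open import Relation.Binary.PropositionalEquality
  using (_≡_; refl; sym; trans; cong; cong₂; subst; module ≡-Reasoning)

private
  variable
    a p q : Level

module _ {A : Set a} {P : Pred A p} (P? : Decidable₁ P) where


  length-filter+length-filter-∁ : ∀ xs → length (filter P? xs) + length (filter (∁? P?) xs) ≡ length xs
  length-filter+length-filter-∁ [] = refl
  length-filter+length-filter-∁ (x ∷ xs) with P? x
  ... | yes _ = cong suc (length-filter+length-filter-∁ xs)
  ... | no _ = trans (+-suc _ _) (cong suc (length-filter+length-filter-∁ xs))

  filter-filter-⇒ : {Q : Pred A q} (Q? : Decidable₁ Q) → (∀ {x} → P x → Q x) →
                    ∀ xs → filter P? (filter Q? xs) ≡ filter P? xs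
  filter-filter-⇒ Q? P⇒Q [] = refl
  filter-filter-⇒ Q? P⇒Q (x ∷ xs) with Q? x
  ... | no ¬q = trans (filter-filter-⇒ Q? P⇒Q xs) (sym (filter-reject P? (¬q ∘ P⇒Q)))
  ... | yes _ with P? x
  ...   | yes _ = cong (x ∷_) (filter-filter-⇒ Q? P⇒Q xs)
  ...   | no _ = filter-filter-⇒ Q? P⇒Q xs

module Occurrences {A : Set a} (_≟_ : DecidableEquality A) where

  occ : A → List A → ℕ
  occ a xs = length (filter (a ≟_) xs)

  occ-mono : ∀ a {xs ys} → xs ⊆ ys → occ a xs ≤ occ a ys
  occ-mono a xs⊆ys = length-mono-≤ (filter⁺ (a ≟_) (a ≟_) (λ { refl p → p }) xs⊆ys)

  ∈⇒1≤occ : ∀ {a xs} → a ∈ xs → 1 ≤ occ a xs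
  ∈⇒1≤occ {a} = filter-some (a ≟_)

  without : A → List A → List A
  without a = filter (∁? (a ≟_))

  occ+length-without : ∀ a xs → occ a xs + length (without a xs) ≡ length xs
  occ+length-without a = length-filter+length-filter-∁ (a ≟_)

  occ-without : ∀ {a b} → ¬ a ≡ b → ∀ xs → occ b (without a xs) ≡ occ b xs
  occ-without a≢b xs = cong length (filter-filter-⇒ (_ ≟_) (∁? (_ ≟_)) (λ { refl refl → a≢b refl }) xs)

  unique-occ-bound : ∀ {k} B ys → Unique B → All (λ b → k ≤ occ b ys) B → length B * k ≤ length ys
  unique-occ-bound [] ys [] [] = z≤n
  unique-occ-bound {k} (b ∷ B) ys (b∉B ∷ uniqueB) (k≤occ-b ∷ k≤occs) = begin
    k + length B * k                       ≤⟨ +-mono-≤ k≤occ-b (unique-occ-bound B (without b ys) uniqueB k≤occs′) ⟩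
    occ b ys + length (without b ys)       ≡⟨ occ+length-without b ys ⟩
    length ys                              ∎
    where
    open ≤-Reasoning
    k≤occs′ : All (λ b′ → k ≤ occ b′ (without b ys)) B
    k≤occs′ = All.zipWith (λ (b≢b′ , k≤) → subst (k ≤_) (sym (occ-without b≢b′ ys)) k≤) (b∉B , k≤occs)

  unique-⊆-length : ∀ B ys → Unique B → All (_∈ ys) B → length B ≤ length ys
  unique-⊆-length B ys uniqueB B⊆ys =
    subst (_≤ length ys) (*-identityʳ (length B)) (unique-occ-bound B ys uniqueB (All.map ∈⇒1≤occ B⊆ys))

  2≤occ-twice : ∀ a xs → 2 ≤ occ a (a ∷ a ∷ xs)
  2≤occ-twice a xs
    rewrite filter-accept (a ≟_) {a} {a ∷ xs} refl | filter-accept (a ≟_) {a} {xs} refl = s≤s (s≤s z≤n)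

⌊m*2/2⌋≡m : ∀ m → ⌊ m * 2 /2⌋ ≡ m
⌊m*2/2⌋≡m zero = refl
⌊m*2/2⌋≡m (suc m) = cong suc (⌊m*2/2⌋≡m m)

⌊1+m*2/2⌋≡m : ∀ m → ⌊ suc (m * 2) /2⌋ ≡ m
⌊1+m*2/2⌋≡m zero = refl
⌊1+m*2/2⌋≡m (suc m) = cong suc (⌊1+m*2/2⌋≡m m)

m*2≤n⇒m≤⌊n/2⌋ : ∀ {m n} → m * 2 ≤ n → m ≤ ⌊ n /2⌋
m*2≤n⇒m≤⌊n/2⌋ {m} m*2≤n = subst (_≤ _) (⌊m*2/2⌋≡m m) (⌊n/2⌋-mono m*2≤n)

sumHalves : ℕ → ℕ
sumHalves zero = 0
sumHalves (suc n) = sumHalves n + ⌊ n /2⌋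

sumHalves[1+m*2]≡m*m : ∀ m → sumHalves (suc (m * 2)) ≡ m * m
sumHalves[1+m*2]≡m*m zero = refl
sumHalves[1+m*2]≡m*m (suc m) = begin
  sumHalves (suc (m * 2)) + ⌊ suc (m * 2) /2⌋ + suc ⌊ m * 2 /2⌋
    ≡⟨ cong₂ _+_ (cong₂ _+_ (sumHalves[1+m*2]≡m*m m) (⌊1+m*2/2⌋≡m m)) (cong suc (⌊m*2/2⌋≡m m)) ⟩
  m * m + m + suc m
    ≡⟨ solve 1 (λ m → m :* m :+ m :+ (con 1 :+ m) := (con 1 :+ m) :* (con 1 :+ m)) refl m ⟩
  suc m * suc m ∎
  where open ≡-Reasoning

-- Stated without subtraction so that it is a semiring identity.
sumHalves[m*2]*4+2*[m*2]≡[m*2]² : ∀ m → sumHalves (m * 2) * 4 + 2 * (m * 2) ≡ m * 2 * (m * 2)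
sumHalves[m*2]*4+2*[m*2]≡[m*2]² zero = refl
sumHalves[m*2]*4+2*[m*2]≡[m*2]² (suc m) = begin
  (sumHalves (suc (m * 2)) + ⌊ suc (m * 2) /2⌋) * 4 + 2 * (suc m * 2)
    ≡⟨ cong (λ s → s * 4 + 2 * (suc m * 2)) (cong₂ _+_ (sumHalves[1+m*2]≡m*m m) (⌊1+m*2/2⌋≡m m)) ⟩
  (m * m + m) * 4 + 2 * (suc m * 2)
    ≡⟨ solve 1 (λ m → (m :* m :+ m) :* con 4 :+ con 2 :* ((con 1 :+ m) :* con 2)
                      := (con 1 :+ m) :* con 2 :* ((con 1 :+ m) :* con 2)) refl m ⟩
  suc m * 2 * (suc m * 2) ∎
  where open ≡-Reasoning

n%2≡r⇒n≡r+[n/2]*2 : ∀ n {r} → n % 2 ≡ r → n ≡ r + n / 2 * 2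
n%2≡r⇒n≡r+[n/2]*2 n n%2≡r = trans (m≡m%n+[m/n]*n n 2) (cong (_+ n / 2 * 2) n%2≡r)

sumHalves-even : ∀ m → sumHalves (m * 2) ≡ (m * 2 * (m * 2) ∸ 2 * (m * 2)) / 4
sumHalves-even m = begin
  sumHalves (m * 2)                                         ≡⟨ m*n/n≡m (sumHalves (m * 2)) 4 ⟨
  sumHalves (m * 2) * 4 / 4                                 ≡⟨ cong (_/ 4) (m+n∸n≡m (sumHalves (m * 2) * 4) (2 * (m * 2))) ⟨
  (sumHalves (m * 2) * 4 + 2 * (m * 2) ∸ 2 * (m * 2)) / 4   ≡⟨ cong (λ t → (t ∸ 2 * (m * 2)) / 4) (sumHalves[m*2]*4+2*[m*2]≡[m*2]² m) ⟩
  (m * 2 * (m * 2) ∸ 2 * (m * 2)) / 4                       ∎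
  where open ≡-Reasoning

sumHalves-odd : ∀ m → sumHalves (suc (m * 2)) ≡ ((suc (m * 2) ∸ 1) / 2) ^ 2
sumHalves-odd m = begin
  sumHalves (suc (m * 2))   ≡⟨ sumHalves[1+m*2]≡m*m m ⟩
  m * m                     ≡⟨ cong (m *_) (*-identityʳ m) ⟨
  m ^ 2                     ≡⟨ cong (_^ 2) (m*n/n≡m m 2) ⟨
  (m * 2 / 2) ^ 2           ∎
  where open ≡-Reasoning

scatteredSubwords⇒⊆ : ∀ {A : Set} {p : List A} w → p ∈ scatteredSubwords w → p ⊆ w
scatteredSubwords⇒⊆ [] (here refl) = []
scatteredSubwords⇒⊆ (x ∷ w) p∈ with ∈-++⁻ (map (x ∷_) (scatteredSubwords w)) p∈
... | inj₂ p∈′ = x ∷ʳ scatteredSubwords⇒⊆ w p∈′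
... | inj₁ p∈x∷ with ∈-map⁻ (x ∷_) p∈x∷
...   | q , q∈ , refl = refl ∷ scatteredSubwords⇒⊆ w q∈

palindrome₄-shape : ∀ {A : Set} {p : List A} → length p ≡ 4 → reverse p ≡ p → ∃₂ λ a c → p ≡ a ∷ c ∷ c ∷ a ∷ []
palindrome₄-shape {p = a ∷ b ∷ c ∷ d ∷ []} refl refl = a , b , refl

module Palindromes₄ {Σ : Set} (_≟Σ_ : DecidableEquality Σ) where

  open Occurrences _≟Σ_

  IsPalindrome₄? : Decidable₁ (λ (p : List Σ) → length p ≡ 4 × reverse p ≡ p)
  IsPalindrome₄? p = (length p ≟ℕ 4) ×-dec ≡-dec _≟Σ_ (reverse p) p

  -- SP _≟Σ_ 4 w unfolds to length (palindromes₄ w).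
  palindromes₄ : List Σ → List (List Σ)
  palindromes₄ w = deduplicate (≡-dec _≟Σ_) (filter IsPalindrome₄? (scatteredSubwords w))

  repeated : List Σ → List Σ
  repeated w = deduplicate _≟Σ_ (filter (λ c → 2 ≤? occ c w) w)

  ⊆⇒∈-repeated : ∀ {c xs w} → c ∷ c ∷ xs ⊆ w → c ∈ repeated w
  ⊆⇒∈-repeated {c} {xs} {w} cc⊆w =
    ∈-deduplicate⁺ _≟Σ_ (∈-filter⁺ (λ c → 2 ≤? occ c w) (lookup cc⊆w (here refl))
                                   (≤-trans (2≤occ-twice c xs) (occ-mono c cc⊆w)))

  length-repeated : ∀ w → length (repeated w) ≤ ⌊ length w /2⌋
  length-repeated w = m*2≤n⇒m≤⌊n/2⌋ (unique-occ-bound (repeated w) w (UniqueDec.deduplicate-! _≟Σ_ _) 2≤occs)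
    where
    2≤occs : All (λ c → 2 ≤ occ c w) (repeated w)
    2≤occs = All.tabulate λ c∈ → proj₂ (∈-filter⁻ (λ c → 2 ≤? occ c w) {xs = w} (∈-deduplicate⁻ _≟Σ_ _ c∈))

  palindromes₄-∷ : ∀ x w → All (_∈ palindromes₄ w ++ map (λ c → x ∷ c ∷ c ∷ x ∷ []) (repeated w))
                                (palindromes₄ (x ∷ w))
  palindromes₄-∷ x w = All.tabulate λ p∈ → classify (∈-filter⁻ IsPalindrome₄? (∈-deduplicate⁻ _ _ p∈))
    where
    classify : ∀ {p} → p ∈ scatteredSubwords (x ∷ w) × (length p ≡ 4 × reverse p ≡ p) →
               p ∈ palindromes₄ w ++ map (λ c → x ∷ c ∷ c ∷ x ∷ []) (repeated w)
    classify (p∈ , pal) with ∈-++⁻ (map (x ∷_) (scatteredSubwords w)) p∈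
    ... | inj₂ p∈w = ∈-++⁺ˡ (∈-deduplicate⁺ _ (∈-filter⁺ IsPalindrome₄? p∈w pal))
    ... | inj₁ p∈x∷ with ∈-map⁻ (x ∷_) p∈x∷
    ...   | q , q∈ , refl with palindrome₄-shape (proj₁ pal) (proj₂ pal)
    ...     | .x , c , refl = ∈-++⁺ʳ _ (∈-map⁺ _ (⊆⇒∈-repeated (scatteredSubwords⇒⊆ w q∈)))

  SP₄-∷ : ∀ x w → SP _≟Σ_ 4 (x ∷ w) ≤ SP _≟Σ_ 4 w + ⌊ length w /2⌋
  SP₄-∷ x w = begin
    length (palindromes₄ (x ∷ w))
      ≤⟨ Occurrences.unique-⊆-length (≡-dec _≟Σ_) _ _ (UniqueDec.deduplicate-! (≡-dec _≟Σ_) _) (palindromes₄-∷ x w) ⟩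
    length (palindromes₄ w ++ map pal (repeated w))
      ≡⟨ length-++ (palindromes₄ w) ⟩
    length (palindromes₄ w) + length (map pal (repeated w))
      ≡⟨ cong (length (palindromes₄ w) +_) (length-map pal (repeated w)) ⟩
    length (palindromes₄ w) + length (repeated w)
      ≤⟨ +-monoʳ-≤ (length (palindromes₄ w)) (length-repeated w) ⟩
    length (palindromes₄ w) + ⌊ length w /2⌋ ∎
    where
    open ≤-Reasoning
    pal : Σ → List Σ
    pal c = x ∷ c ∷ c ∷ x ∷ []

  SP₄≤sumHalves : ∀ w → SP _≟Σ_ 4 w ≤ sumHalves (length w)
  SP₄≤sumHalves [] = z≤n
  SP₄≤sumHalves (x ∷ w) = ≤-trans (SP₄-∷ x w) (+-monoˡ-≤ ⌊ length w /2⌋ (SP₄≤sumHalves w))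

corollary4p9 : {Σ : Set} (_≟Σ_ : DecidableEquality Σ) (n : ℕ) (w : List Σ) →
    length w ≡ n → 1 ≤ n →
    (n % 2 ≡ 0 → SP _≟Σ_ 4 w ≤ (n * n ∸ 2 * n) / 4) ×
    (n % 2 ≡ 1 → SP _≟Σ_ 4 w ≤ ((n ∸ 1) / 2) ^ 2)
corollary4p9 _≟Σ_ n w refl _ = even , odd
  where
  open Palindromes₄ _≟Σ_ using (SP₄≤sumHalves)
  even : n % 2 ≡ 0 → SP _≟Σ_ 4 w ≤ (n * n ∸ 2 * n) / 4
  even n%2≡0 = ≤-trans (SP₄≤sumHalves w) (≤-reflexive
    (subst (λ k → sumHalves k ≡ (k * k ∸ 2 * k) / 4) (sym (n%2≡r⇒n≡r+[n/2]*2 n n%2≡0)) (sumHalves-even (n / 2))))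
  odd : n % 2 ≡ 1 → SP _≟Σ_ 4 w ≤ ((n ∸ 1) / 2) ^ 2
  odd n%2≡1 = ≤-trans (SP₄≤sumHalves w) (≤-reflexive
    (subst (λ k → sumHalves k ≡ ((k ∸ 1) / 2) ^ 2) (sym (n%2≡r⇒n≡r+[n/2]*2 n n%2≡1)) (sumHalves-odd (n / 2))))
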